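{- If $G$ is a finite simple connected graph with $n$ vertices and diameter $d \geq 2$, then $$\operatorname{sg}(G) \geq \left\lceil \frac{d-3+\sqrt{(d-3)^2 + 8n(d-1)}}{2(d-1)}\right\rceil.$$
   Context: For a graph $G=(V,E)$ and a set $S\subseteq V$, for each pair of distinct vertices $\{x,y\}\subseteq S$ one selects one fixed shortest $x,y$-path $\widetilde g(x,y)$. The set $S$ is a strong geodetic set if for some such choice of fixed shortest paths, every vertex of $G$ lies on at least one of the selected paths. The strong geodetic number $\operatorname{sg}(G)$ is the minimum cardinality of a strong geodetic set of $G$. -}

module Defs where

open import Data.Nat using (ℕ; zero; suc; _≤_)
open import Data.Fin using (Fin; toℕ)
open import Data.Fin.Subset using (Subset; _∈_; ∣_∣)
open import Data.Product using (Σ; ∃; ∃-syntax; _×_; _,_; proj₁)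
open import Relation.Nullary using (¬_)
open import Relation.Binary.PropositionalEquality using (_≡_)
import Data.Nat as ℕ

record Graph (n : ℕ) : Set₁ where
  field
    Adj    : Fin n → Fin n → Set
    sym    : ∀ {x y} → Adj x y → Adj y x
    irrefl : ∀ {x} → ¬ Adj x x

module _ {n : ℕ} (G : Graph n) where
  open Graph G

  data Walk : Fin n → Fin n → ℕ → Set where
    []  : ∀ {x} → Walk x x 0
    _∷_ : ∀ {x y z k} → Adj x y → Walk y z k → Walk x z (suc k)

  data OnWalk (v : Fin n) : ∀ {x z k} → Walk x z k → Set where
    here  : ∀ {z k} {w : Walk v z k} → OnWalk v w
    there : ∀ {x y z k} {a : Adj x y} {w : Walk y z k} →
            OnWalk v w → OnWalk v (a ∷ w)

  record Geodesic (x y : Fin n) : Set where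
    constructor geodesic
    field
      len      : ℕ
      walk     : Walk x y len
      shortest : ∀ {m} → Walk x y m → len ≤ m

  Connected : Set
  Connected = ∀ x y → ∃[ k ] Walk x y k

  HasDiameter : ℕ → Set
  HasDiameter d =
    (∀ x y → ∃[ k ] (k ≤ d × Walk x y k)) ×
    (∃[ x ] ∃[ y ] (∀ {m} → Walk x y m → d ≤ m))

  -- A choice of one fixed shortest path for each unordered pair {x,y} ⊆ S
  -- (indexed by the ordered representative x < y).
  PathChoice : Subset n → Set
  PathChoice S = ∀ x y → x ∈ S → y ∈ S → toℕ x ℕ.< toℕ y → Geodesic x y

  IsStrongGeodetic : Subset n → Set
  IsStrongGeodetic S =
    Σ (PathChoice S) λ g →
      ∀ v → ∃[ x ] ∃[ y ] Σ (x ∈ S) λ px → Σ (y ∈ S) λ py →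
        Σ (toℕ x ℕ.< toℕ y) λ lt → OnWalk v (Geodesic.walk (g x y px py lt))

  IsSGNumber : ℕ → Set
  IsSGNumber k =
    (∃[ S ] (IsStrongGeodetic S × ∣ S ∣ ≡ k)) ×
    (∀ S → IsStrongGeodetic S → k ≤ ∣ S ∣)

{-# OPTIONS --safe #-}
-- Let S be a strong geodetic set of size k. Every vertex is either in S or an interior vertex
-- of one of the C(k,2) chosen geodesics, and a geodesic has at most d + 1 vertices, hence at
-- most d - 1 interior ones. So n ≤ k + C(k,2)(d - 1), which rearranges to the stated bound.
module Submission where

open import Defs
open import Data.Nat using (ℕ; zero; suc; _+_; _*_; _∸_; _≤_; z≤n; s≤s)
open import Data.Nat.Properties using (≤-trans; ≤-reflexive; +-mono-≤; +-monoˡ-≤; *-monoʳ-≤; ∸-monoˡ-≤; module ≤-Reasoning)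
open import Data.Nat.Combinatorics using (_C_; nC1≡n; nCk+nC[k+1]≡[n+1]C[k+1])
open import Data.Nat.Tactic.RingSolver using (solve-∀)
open import Data.Fin using (Fin; zero; suc; _<_)
open import Data.Fin.Properties using (<-cmp; <-asym; <-irrelevant; <⇒≢; injective⇒≤)
open import Data.Fin.Subset using (Subset; ∣_∣; inside; outside) renaming (_∈_ to _∈ₛ_)
open import Data.Vec using ([]; _∷_; here; there)
open import Data.List using (List; []; _∷_; _++_; map; length; concatMap; lookup)
open import Data.List.Properties using (length-map; length-++)
open import Data.List.Relation.Unary.Any using (Any; here; there; index)
open import Data.List.Relation.Unary.Any.Properties using (lookup-index)
open import Data.List.Membership.Propositional using (_∈_; lose)
open import Data.List.Membership.Propositional.Properties using (∈-map⁺; ∈-++⁺ˡ; ∈-++⁺ʳ; ∈-concatMap⁺)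
open import Data.Product using (Σ; _×_; _,_; proj₁; proj₂; uncurry)
open import Data.Sum using (_⊎_; inj₁; inj₂)
import Data.Sum as Sum
open import Function using (_∘_)
open import Relation.Binary using (tri<; tri≈; tri>)
open import Relation.Binary.PropositionalEquality using (_≡_; _≢_; refl; cong; cong₂; trans; subst; module ≡-Reasoning)
open import Relation.Nullary using (contradiction)

pairs : ∀ {A : Set} → List A → List (A × A)
pairs []       = []
pairs (x ∷ xs) = map (x ,_) xs ++ pairs xs

[1+n]C2≡n+nC2 : ∀ n → suc n C 2 ≡ n + n C 2
[1+n]C2≡n+nC2 n = begin
  suc n C 2         ≡⟨ nCk+nC[k+1]≡[n+1]C[k+1] n 1 ⟨
  n C 1 + n C 2     ≡⟨ cong (_+ n C 2) (nC1≡n n) ⟩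
  n + n C 2         ∎
  where open ≡-Reasoning

2*nC2+n≡n*n : ∀ n → 2 * (n C 2) + n ≡ n * n
2*nC2+n≡n*n zero    = refl
2*nC2+n≡n*n (suc n) = begin
  2 * (suc n C 2) + suc n       ≡⟨ cong (λ m → 2 * m + suc n) ([1+n]C2≡n+nC2 n) ⟩
  2 * (n + n C 2) + suc n       ≡⟨ regroup n (n C 2) ⟩
  suc n + n + (2 * (n C 2) + n) ≡⟨ cong (suc n + n +_) (2*nC2+n≡n*n n) ⟩
  suc n + n + n * n             ≡⟨ square n ⟩
  suc n * suc n                 ∎
  where
  open ≡-Reasoning
  regroup : ∀ a b → 2 * (a + b) + suc a ≡ suc a + a + (2 * b + a)
  regroup = solve-∀
  square : ∀ a → suc a + a + a * a ≡ suc a * suc a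
  square = solve-∀

length-pairs : ∀ {A : Set} (xs : List A) → length (pairs xs) ≡ length xs C 2
length-pairs []       = refl
length-pairs (x ∷ xs) = begin
  length (map (x ,_) xs ++ pairs xs)        ≡⟨ length-++ (map (x ,_) xs) ⟩
  length (map (x ,_) xs) + length (pairs xs) ≡⟨ cong₂ _+_ (length-map (x ,_) xs) (length-pairs xs) ⟩
  length xs + length xs C 2                  ≡⟨ [1+n]C2≡n+nC2 (length xs) ⟨
  suc (length xs) C 2                        ∎
  where open ≡-Reasoning

∈-pairs : ∀ {A : Set} {x y : A} {xs : List A} → x ∈ xs → y ∈ xs → x ≢ y →
          (x , y) ∈ pairs xs ⊎ (y , x) ∈ pairs xs
∈-pairs              (here refl) (here refl) x≢y = contradiction refl x≢y
∈-pairs {xs = z ∷ _} (here refl) (there y∈)  _   = inj₁ (∈-++⁺ˡ (∈-map⁺ (z ,_) y∈))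
∈-pairs {xs = z ∷ _} (there x∈)  (here refl) _   = inj₂ (∈-++⁺ˡ (∈-map⁺ (z ,_) x∈))
∈-pairs {xs = z ∷ zs} (there x∈) (there y∈) x≢y =
  Sum.map (∈-++⁺ʳ (map (z ,_) zs)) (∈-++⁺ʳ (map (z ,_) zs)) (∈-pairs x∈ y∈ x≢y)

length-concatMap-≤ : ∀ {A B : Set} (f : A → List B) {c : ℕ} → (∀ a → length (f a) ≤ c) →
                     ∀ xs → length (concatMap f xs) ≤ length xs * c
length-concatMap-≤ f     f≤c []       = z≤n
length-concatMap-≤ f {c} f≤c (x ∷ xs) = begin
  length (f x ++ concatMap f xs)         ≡⟨ length-++ (f x) ⟩
  length (f x) + length (concatMap f xs) ≤⟨ +-mono-≤ (f≤c x) (length-concatMap-≤ f f≤c xs) ⟩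
  c + length xs * c                      ∎
  where open ≤-Reasoning

complete⇒n≤length : ∀ {n} (xs : List (Fin n)) → (∀ v → v ∈ xs) → n ≤ length xs
complete⇒n≤length xs v∈xs = injective⇒≤ {f = λ v → index (v∈xs v)} index-injective
  where
  index-injective : ∀ {v w} → index (v∈xs v) ≡ index (v∈xs w) → v ≡ w
  index-injective {v} {w} eq = begin
    v                             ≡⟨ lookup-index (v∈xs v) ⟩
    lookup xs (index (v∈xs v))    ≡⟨ cong (lookup xs) eq ⟩
    lookup xs (index (v∈xs w))    ≡⟨ lookup-index (v∈xs w) ⟨
    w                             ∎
    where open ≡-Reasoning

members : ∀ {n} (S : Subset n) → List (Σ (Fin n) (_∈ₛ S))
members []            = []
members (inside ∷ S)  = (zero , here) ∷ map (λ (x , x∈S) → suc x , there x∈S) (members S)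
members (outside ∷ S) = map (λ (x , x∈S) → suc x , there x∈S) (members S)

length-members : ∀ {n} (S : Subset n) → length (members S) ≡ ∣ S ∣
length-members []            = refl
length-members (inside ∷ S)  = cong suc (trans (length-map _ (members S)) (length-members S))
length-members (outside ∷ S) = trans (length-map _ (members S)) (length-members S)

∈-members : ∀ {n} {S : Subset n} {x} (x∈S : x ∈ₛ S) → (x , x∈S) ∈ members S
∈-members {S = inside ∷ S}  here        = here refl
∈-members {S = inside ∷ S}  (there x∈S) = there (∈-map⁺ _ (∈-members x∈S))
∈-members {S = outside ∷ S} (there x∈S) = ∈-map⁺ _ (∈-members x∈S)

module _ {n : ℕ} (G : Graph n) where

  interior : ∀ {x z k} → Walk G x z k → List (Fin n)
  interior []                        = []
  interior (_ ∷ [])                  = []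
  interior (_∷_ {y = y} _ w@(_ ∷ _)) = y ∷ interior w

  length-interior : ∀ {x z k} (w : Walk G x z k) → length (interior w) ≡ k ∸ 1
  length-interior []              = refl
  length-interior (_ ∷ [])        = refl
  length-interior (_ ∷ w@(_ ∷ _)) = cong suc (length-interior w)

  onWalk⇒endpoint⊎interior : ∀ {v x z k} {w : Walk G x z k} → OnWalk G v w →
                             v ≡ x ⊎ v ≡ z ⊎ v ∈ interior w
  onWalk⇒endpoint⊎interior here                    = inj₁ refl
  onWalk⇒endpoint⊎interior (there {w = []} here)   = inj₂ (inj₁ refl)
  onWalk⇒endpoint⊎interior (there {w = _ ∷ _} v∈w) with onWalk⇒endpoint⊎interior v∈w
  ... | inj₁ refl        = inj₂ (inj₂ (here refl))
  ... | inj₂ (inj₁ v≡z)  = inj₂ (inj₁ v≡z)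
  ... | inj₂ (inj₂ v∈ws) = inj₂ (inj₂ (there v∈ws))

  geodesic-len≤diameter : ∀ {d x y} → HasDiameter G d → (γ : Geodesic G x y) → Geodesic.len γ ≤ d
  geodesic-len≤diameter {x = x} {y} (within-d , _) γ with within-d x y
  ... | (k , k≤d , w) = ≤-trans (Geodesic.shortest γ w) k≤d

  geodesicInterior : ∀ {x y} → Geodesic G x y → List (Fin n)
  geodesicInterior γ = interior (Geodesic.walk γ)

  length-geodesicInterior≤ : ∀ {d x y} → HasDiameter G d → (γ : Geodesic G x y) →
                             length (geodesicInterior γ) ≤ d ∸ 1
  length-geodesicInterior≤ {d} diam γ = begin
    length (geodesicInterior γ) ≡⟨ length-interior (Geodesic.walk γ) ⟩
    Geodesic.len γ ∸ 1          ≤⟨ ∸-monoˡ-≤ 1 (geodesic-len≤diameter diam γ) ⟩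
    d ∸ 1                       ∎
    where open ≤-Reasoning

  module _ {S : Subset n} (g : PathChoice G S) where

    pairInterior : Σ (Fin n) (_∈ₛ S) → Σ (Fin n) (_∈ₛ S) → List (Fin n)
    pairInterior (x , x∈S) (y , y∈S) with <-cmp x y
    ... | tri< x<y _ _ = geodesicInterior (g x y x∈S y∈S x<y)
    ... | tri≈ _ _ _   = []
    ... | tri> _ _ y<x = geodesicInterior (g y x y∈S x∈S y<x)

    length-pairInterior≤ : ∀ {d} → HasDiameter G d → ∀ a b → length (pairInterior a b) ≤ d ∸ 1
    length-pairInterior≤ diam (x , x∈S) (y , y∈S) with <-cmp x y
    ... | tri< x<y _ _ = length-geodesicInterior≤ diam (g x y x∈S y∈S x<y)
    ... | tri≈ _ _ _   = z≤n
    ... | tri> _ _ y<x = length-geodesicInterior≤ diam (g y x y∈S x∈S y<x)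

    ∈-pairInterior : ∀ {v x y} {x∈S : x ∈ₛ S} {y∈S : y ∈ₛ S} (x<y : x < y) →
                     v ∈ geodesicInterior (g x y x∈S y∈S x<y) →
                     v ∈ pairInterior (x , x∈S) (y , y∈S) × v ∈ pairInterior (y , y∈S) (x , x∈S)
    ∈-pairInterior {v} {x} {y} {x∈S} {y∈S} x<y v∈γ = forward , backward
      where
      v∈γ′ : ∀ x<y′ → v ∈ geodesicInterior (g x y x∈S y∈S x<y′)
      v∈γ′ x<y′ = subst (λ p → v ∈ geodesicInterior (g x y x∈S y∈S p)) (<-irrelevant x<y x<y′) v∈γ

      forward : v ∈ pairInterior (x , x∈S) (y , y∈S)
      forward with <-cmp x y
      ... | tri< x<y′ _ _ = v∈γ′ x<y′
      ... | tri≈ x≮y _ _  = contradiction x<y x≮y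
      ... | tri> x≮y _ _  = contradiction x<y x≮y

      backward : v ∈ pairInterior (y , y∈S) (x , x∈S)
      backward with <-cmp y x
      ... | tri< y<x _ _  = contradiction y<x (<-asym x<y)
      ... | tri≈ _ _ y≯x  = contradiction x<y y≯x
      ... | tri> _ _ x<y′ = v∈γ′ x<y′

    coveredVertices : List (Fin n)
    coveredVertices = map proj₁ (members S) ++ concatMap (uncurry pairInterior) (pairs (members S))

    length-coveredVertices≤ : ∀ {d} → HasDiameter G d → length coveredVertices ≤ ∣ S ∣ + (∣ S ∣ C 2) * (d ∸ 1)
    length-coveredVertices≤ {d} diam = begin
      length coveredVertices
        ≡⟨ length-++ (map proj₁ (members S)) ⟩
      length (map proj₁ (members S)) + length (concatMap (uncurry pairInterior) (pairs (members S)))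
        ≤⟨ +-mono-≤ (≤-reflexive (length-map proj₁ (members S)))
                    (length-concatMap-≤ _ (uncurry (length-pairInterior≤ diam)) (pairs (members S))) ⟩
      length (members S) + length (pairs (members S)) * (d ∸ 1)
        ≡⟨ cong₂ (λ k p → k + p * (d ∸ 1)) (length-members S)
                 (trans (length-pairs (members S)) (cong (_C 2) (length-members S))) ⟩
      ∣ S ∣ + (∣ S ∣ C 2) * (d ∸ 1) ∎
      where open ≤-Reasoning

    ∈-coveredVertices : ∀ {v x y} (x∈S : x ∈ₛ S) (y∈S : y ∈ₛ S) (x<y : x < y) →
                        OnWalk G v (Geodesic.walk (g x y x∈S y∈S x<y)) → v ∈ coveredVertices
    ∈-coveredVertices {v} x∈S y∈S x<y v∈γ with onWalk⇒endpoint⊎interior v∈γ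
    ... | inj₁ refl        = ∈-++⁺ˡ (∈-map⁺ proj₁ (∈-members x∈S))
    ... | inj₂ (inj₁ refl) = ∈-++⁺ˡ (∈-map⁺ proj₁ (∈-members y∈S))
    ... | inj₂ (inj₂ v∈γ°) = ∈-++⁺ʳ _ (∈-concatMap⁺ (uncurry pairInterior) v∈pairInterior)
      where
      v∈pairInterior : Any ((v ∈_) ∘ uncurry pairInterior) (pairs (members S))
      v∈pairInterior with ∈-pairs (∈-members x∈S) (∈-members y∈S) (<⇒≢ x<y ∘ cong proj₁)
      ... | inj₁ xy∈pairs = lose xy∈pairs (proj₁ (∈-pairInterior x<y v∈γ°))
      ... | inj₂ yx∈pairs = lose yx∈pairs (proj₂ (∈-pairInterior x<y v∈γ°))

  strongGeodetic⇒n≤ : ∀ {d S} → HasDiameter G d → IsStrongGeodetic G S →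
                      n ≤ ∣ S ∣ + (∣ S ∣ C 2) * (d ∸ 1)
  strongGeodetic⇒n≤ diam (g , covers) =
    ≤-trans (complete⇒n≤length (coveredVertices g) covered) (length-coveredVertices≤ g diam)
    where
    covered : ∀ v → v ∈ coveredVertices g
    covered v with (_ , _ , x∈S , y∈S , x<y , v∈γ) ← covers v = ∈-coveredVertices g x∈S y∈S x<y v∈γ

-- Connectivity follows from the diameter hypothesis, and only d ≥ 1 is needed.
theorem3p4 : ∀ (n : ℕ) (G : Graph n) (d : ℕ) → Connected G → HasDiameter G d →
               2 ≤ d → ∀ (k : ℕ) → IsSGNumber G k →
               2 * n + d * k ≤ (d ∸ 1) * (k * k) + 3 * k
theorem3p4 n G (suc c) _ diam (s≤s _) k ((S , S-strong , refl) , _) = begin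
  2 * n + suc c * k                 ≤⟨ +-monoˡ-≤ (suc c * k) (*-monoʳ-≤ 2 (strongGeodetic⇒n≤ G diam S-strong)) ⟩
  2 * (k + (k C 2) * c) + suc c * k ≡⟨ regroup k (k C 2) c ⟩
  c * (2 * (k C 2) + k) + 3 * k     ≡⟨ cong (λ t → c * t + 3 * k) (2*nC2+n≡n*n k) ⟩
  c * (k * k) + 3 * k               ∎
  where
  open ≤-Reasoning
  regroup : ∀ a p e → 2 * (a + p * e) + suc e * a ≡ e * (2 * p + a) + 3 * a
  regroup = solve-∀
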